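{- Let $e_1,\dots,e_4$ be the standard basis of $\mathbb{R}^4$ and consider the cross-polytope $\mathrm{conv}\{\pm e_1,\pm e_2,\pm e_3,\pm e_4\}$. Orient its 24 edges as follows: $e_1\to e_2$, $e_2\to e_3$, $e_3\to e_1$, $-e_1\to-e_2$, $-e_2\to-e_3$, $-e_3\to-e_1$; $-e_2\to e_1$, $-e_3\to e_2$, $-e_1\to e_3$, $e_2\to-e_1$, $e_3\to-e_2$, $e_1\to-e_3$; $e_4\to e_1$, $e_4\to e_2$, $e_4\to e_3$, $-e_4\to-e_1$, $-e_4\to-e_2$, $-e_4\to-e_3$; $-e_1\to e_4$, $-e_2\to e_4$, $-e_3\to e_4$, $e_1\to-e_4$, $e_2\to-e_4$, $e_3\to-e_4$. Let $\mathcal{K}$ be the simplicial complex consisting of all vertices and edges of the cross-polytope and of the 24 triangles of the cross-polytope other than the eight triangles $\{e_1,e_2,e_3\}$, $\{ -e_1,-e_2,-e_3\}$, $\{e_1,-e_4,-e_2\}$, $\{e_2,-e_4,-e_3\}$, $\{e_3,-e_4,-e_1\}$, $\{ -e_1,e_4,e_2\}$, $\{ -e_2,e_4,e_3\}$, $\{ -e_3,e_4,e_1\}$. Then this orientation is locally acyclic on $\mathcal{K}$ (acyclic on every triangle of $\mathcal{K}$) and has no reversible edges.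
   Context: An edge is reversible (with respect to $\mathcal{K}$) if reversing only that edge yields again an orientation that is acyclic on every triangle of $\mathcal{K}$. The triangles of the cross-polytope are the sets $\{\pm e_i,\pm e_j,\pm e_k\}$ with $i,j,k$ distinct (any choice of signs). -}

module Defs where

open import Data.Fin using (Fin; zero; suc)
open import Data.Product using (_×_; _,_)
open import Data.Sum using (_⊎_)
open import Data.List using (List; []; _∷_)
open import Data.List.Relation.Unary.Any using (Any)
open import Data.List.Membership.Propositional using (_∈_)
open import Relation.Binary.PropositionalEquality using (_≡_)
open import Relation.Nullary using (¬_)

data Sign : Set where
  pos neg : Sign

record Vertex : Set where
  constructor v
  field
    sign  : Sign
    index : Fin 4
open Vertex public

e₁ e₂ e₃ e₄ -e₁ -e₂ -e₃ -e₄ : Vertex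
e₁  = v pos zero
e₂  = v pos (suc zero)
e₃  = v pos (suc (suc zero))
e₄  = v pos (suc (suc (suc zero)))
-e₁ = v neg zero
-e₂ = v neg (suc zero)
-e₃ = v neg (suc (suc zero))
-e₄ = v neg (suc (suc (suc zero)))

-- Edges of the cross-polytope: {u, w} with different indices (i.e. not equal, not antipodal).
IsEdge : Vertex → Vertex → Set
IsEdge u w = ¬ (index u ≡ index w)

IsTriangle : Vertex → Vertex → Vertex → Set
IsTriangle a b c = IsEdge a b × IsEdge b c × IsEdge a c

Orientation : Set₁
Orientation = Vertex → Vertex → Set

givenArcs : List (Vertex × Vertex)
givenArcs =
  (e₁ , e₂) ∷ (e₂ , e₃) ∷ (e₃ , e₁) ∷ (-e₁ , -e₂) ∷ (-e₂ , -e₃) ∷ (-e₃ , -e₁) ∷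
  (-e₂ , e₁) ∷ (-e₃ , e₂) ∷ (-e₁ , e₃) ∷ (e₂ , -e₁) ∷ (e₃ , -e₂) ∷ (e₁ , -e₃) ∷
  (e₄ , e₁) ∷ (e₄ , e₂) ∷ (e₄ , e₃) ∷ (-e₄ , -e₁) ∷ (-e₄ , -e₂) ∷ (-e₄ , -e₃) ∷
  (-e₁ , e₄) ∷ (-e₂ , e₄) ∷ (-e₃ , e₄) ∷ (e₁ , -e₄) ∷ (e₂ , -e₄) ∷ (e₃ , -e₄) ∷ []

givenOrientation : Orientation
givenOrientation u w = (u , w) ∈ givenArcs

excludedTriangles : List (Vertex × Vertex × Vertex)
excludedTriangles =
  (e₁ , e₂ , e₃) ∷ (-e₁ , -e₂ , -e₃) ∷ (e₁ , -e₄ , -e₂) ∷ (e₂ , -e₄ , -e₃) ∷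
  (e₃ , -e₄ , -e₁) ∷ (-e₁ , e₄ , e₂) ∷ (-e₂ , e₄ , e₃) ∷ (-e₃ , e₄ , e₁) ∷ []

_∈₃_ : Vertex → Vertex × Vertex × Vertex → Set
w ∈₃ (x , y , z) = w ≡ x ⊎ w ≡ y ⊎ w ≡ z

Excluded : Vertex → Vertex → Vertex → Set
Excluded a b c = Any (λ t → a ∈₃ t × b ∈₃ t × c ∈₃ t) excludedTriangles

IsKTriangle : Vertex → Vertex → Vertex → Set
IsKTriangle a b c = IsTriangle a b c × ¬ Excluded a b c

AcyclicOn : Orientation → Vertex → Vertex → Vertex → Set
AcyclicOn o a b c = ¬ (o a b × o b c × o c a) × ¬ (o a c × o c b × o b a)

LocallyAcyclic : Orientation → Set
LocallyAcyclic o = ∀ a b c → IsKTriangle a b c → AcyclicOn o a b c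

reverseArc : Orientation → Vertex → Vertex → Orientation
reverseArc o u w x y = (o x y × ¬ ((x ≡ u) × (y ≡ w))) ⊎ ((x ≡ w) × (y ≡ u))

Reversible : Orientation → Vertex → Vertex → Set
Reversible o u w = LocallyAcyclic (reverseArc o u w)

NoReversibleEdges : Orientation → Set
NoReversibleEdges o = ∀ u w → IsEdge u w → o u w → ¬ Reversible o u w

-- Every notion in the statement is decidable once the orientation is, and there are only eight
-- vertices, so both claims are settled by evaluating decision procedures: from-yes typechecks
-- exactly when the procedure normalises to yes.
module Submission where

open import Defs
import Data.Fin.Properties as Fin
open import Data.Product using (_×_; _,_)
open import Data.Product.Properties using (≡-dec)
open import Data.List.Relation.Unary.Any using (any?)
open import Relation.Binary.Definitions using (DecidableEquality)
open import Relation.Binary.PropositionalEquality using (refl)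
open import Relation.Nullary using (Dec; yes; no; ¬?; _×-dec_; _⊎-dec_; _→-dec_)
open import Relation.Nullary.Decidable using (map′; from-yes)

DecidableOrientation : Orientation → Set
DecidableOrientation o = ∀ u w → Dec (o u w)

_≟ˢ_ : DecidableEquality Sign
pos ≟ˢ pos = yes refl
neg ≟ˢ neg = yes refl
pos ≟ˢ neg = no λ ()
neg ≟ˢ pos = no λ ()

_≟ᵛ_ : DecidableEquality Vertex
v s i ≟ᵛ v t j = map′ (λ { (refl , refl) → refl }) (λ { refl → refl , refl }) (s ≟ˢ t ×-dec i Fin.≟ j)

∀-vertex? : {P : Vertex → Set} → (∀ x → Dec (P x)) → Dec (∀ x → P x)
∀-vertex? P? = map′ (λ { (∀⁺ , _) (v pos i) → ∀⁺ i ; (_ , ∀⁻) (v neg i) → ∀⁻ i })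
                    (λ ∀P → (λ i → ∀P (v pos i)) , (λ i → ∀P (v neg i)))
                    (Fin.all? (λ i → P? (v pos i)) ×-dec Fin.all? (λ i → P? (v neg i)))

isEdge? : ∀ u w → Dec (IsEdge u w)
isEdge? u w = ¬? (index u Fin.≟ index w)

excluded? : ∀ a b c → Dec (Excluded a b c)
excluded? a b c = any? (λ t → a ∈₃? t ×-dec b ∈₃? t ×-dec c ∈₃? t) excludedTriangles
  where
  _∈₃?_ : ∀ w t → Dec (w ∈₃ t)
  w ∈₃? (x , y , z) = w ≟ᵛ x ⊎-dec w ≟ᵛ y ⊎-dec w ≟ᵛ z

isKTriangle? : ∀ a b c → Dec (IsKTriangle a b c)
isKTriangle? a b c = (isEdge? a b ×-dec isEdge? b c ×-dec isEdge? a c) ×-dec ¬? (excluded? a b c)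

locallyAcyclic? : ∀ {o} → DecidableOrientation o → Dec (LocallyAcyclic o)
locallyAcyclic? o? =
  ∀-vertex? λ a → ∀-vertex? λ b → ∀-vertex? λ c → isKTriangle? a b c →-dec acyclicOn? a b c
  where
  acyclicOn? : ∀ a b c → Dec (AcyclicOn _ a b c)
  acyclicOn? a b c = ¬? (o? a b ×-dec o? b c ×-dec o? c a) ×-dec ¬? (o? a c ×-dec o? c b ×-dec o? b a)

reverseArc? : ∀ {o} → DecidableOrientation o → ∀ u w → DecidableOrientation (reverseArc o u w)
reverseArc? o? u w x y = (o? x y ×-dec ¬? (x ≟ᵛ u ×-dec y ≟ᵛ w)) ⊎-dec (x ≟ᵛ w ×-dec y ≟ᵛ u)

noReversibleEdges? : ∀ {o} → DecidableOrientation o → Dec (NoReversibleEdges o)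
noReversibleEdges? o? =
  ∀-vertex? λ u → ∀-vertex? λ w →
    isEdge? u w →-dec o? u w →-dec ¬? (locallyAcyclic? (reverseArc? o? u w))

givenOrientation? : DecidableOrientation givenOrientation
givenOrientation? u w = any? (≡-dec _≟ᵛ_ _≟ᵛ_ (u , w)) givenArcs

proposition3p1 : LocallyAcyclic givenOrientation × NoReversibleEdges givenOrientation
proposition3p1 = from-yes (locallyAcyclic? givenOrientation?) , from-yes (noReversibleEdges? givenOrientation?)
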